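{- Let $n\geq 6$ and $k\in\{3,\dots,n-3\}$. Every $k$-spectrally monomorphic $n$-tournament is transitive.
   Context: An $n$-tournament is a digraph on $n$ vertices in which every pair of distinct vertices is joined by exactly one arc; if the arc goes from $u$ to $v$, $u$ dominates $v$. Its adjacency matrix $A=(a_{ij})$ (w.r.t. an ordering $v_1,\dots,v_n$) has $a_{ij}=1$ if $v_i$ dominates $v_j$ and $0$ otherwise. A tournament is $k$-spectrally monomorphic if all $k\times k$ principal submatrices of its adjacency matrix have the same characteristic polynomial $\det(zI-M)$. A tournament is transitive if whenever $u$ dominates $v$ and $v$ dominates $w$, then $u$ dominates $w$. -}

module Defs where

open import Data.Nat using (ℕ; zero; suc)
open import Data.Integer using (ℤ; 0ℤ; 1ℤ; -_) renaming (_+_ to _+ℤ_; _*_ to _*ℤ_)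
open import Data.Fin using (Fin; zero; suc; punchIn; _<_; _≟_)
open import Data.Bool using (Bool; true; false; not; if_then_else_)
open import Data.List using (List; []; _∷_; map)
open import Relation.Binary.PropositionalEquality using (_≡_; _≢_)
open import Relation.Nullary using (does)

-- Polynomials over ℤ as coefficient lists (constant term first).

Poly : Set
Poly = List ℤ

infixl 6 _+P_
infixl 7 _*P_

_+P_ : Poly → Poly → Poly
[] +P q = q
(a ∷ p) +P [] = a ∷ p
(a ∷ p) +P (b ∷ q) = (a +ℤ b) ∷ (p +P q)

scaleP : ℤ → Poly → Poly
scaleP a p = map (a *ℤ_) p

negP : Poly → Poly
negP p = map -_ p

_*P_ : Poly → Poly → Poly
[] *P q = []
(a ∷ p) *P q = scaleP a q +P (0ℤ ∷ (p *P q))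

coeff : Poly → ℕ → ℤ
coeff [] i = 0ℤ
coeff (a ∷ p) zero = a
coeff (a ∷ p) (suc i) = coeff p i

_≈P_ : Poly → Poly → Set
p ≈P q = ∀ i → coeff p i ≡ coeff q i

altSum : ∀ {r} → (Fin r → Poly) → Poly
altSum {zero} f = []
altSum {suc r} f = f zero +P negP (altSum (λ j → f (suc j)))

det : ∀ m → (Fin m → Fin m → Poly) → Poly
det zero M = 1ℤ ∷ []
det (suc m) M =
  altSum (λ j → M zero j *P det m (λ i l → M (suc i) (punchIn j l)))

-- characteristic polynomial det(zI - M) of an integer matrix
charPoly : ∀ m → (Fin m → Fin m → ℤ) → Poly
charPoly m M = det m (λ i j →
  if does (i ≟ j) then (- M i j) ∷ 1ℤ ∷ [] else (- M i j) ∷ [])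

record Tournament (n : ℕ) : Set where
  field
    dom   : Fin n → Fin n → Bool          -- dom u v = true iff u dominates v
    irrefl : ∀ u → dom u u ≡ false
    tourn  : ∀ u v → u ≢ v → dom u v ≡ not (dom v u)
open Tournament public

adj : ∀ {n} → Tournament n → Fin n → Fin n → ℤ
adj T i j = if dom T i j then 1ℤ else 0ℤ

-- strictly increasing maps Fin k → Fin n (= k-subsets of vertices)
StrictlyIncreasing : ∀ {k n} → (Fin k → Fin n) → Set
StrictlyIncreasing f = ∀ i j → i < j → f i < f j

principal : ∀ {k n} → (Fin n → Fin n → ℤ) → (Fin k → Fin n) → Fin k → Fin k → ℤ
principal A f i j = A (f i) (f j)

SpectrallyMonomorphic : ∀ {n} → ℕ → Tournament n → Set
SpectrallyMonomorphic {n} k T =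
  ∀ (f g : Fin k → Fin n) → StrictlyIncreasing f → StrictlyIncreasing g →
  charPoly k (principal (adj T) f) ≈P charPoly k (principal (adj T) g)

Transitive : ∀ {n} → Tournament n → Set
Transitive T = ∀ u v w → dom T u v ≡ true → dom T v w ≡ true → dom T u w ≡ true

{-# OPTIONS --safe #-}
-- For a zero-diagonal matrix M of size m ≥ 3, the coefficient of z^(m−3) in det(zI − M) is minus
-- the weighted number of 3-cycles of M; expanding along the first row, it is computed from the two top
-- coefficients of det(zI − M) with one column replaced by a vector. Hence all k-subsets of a
-- k-spectrally monomorphic tournament span the same number of cyclic triangles.
-- Let c x a b be 1 if {x, a, b} is a cyclic triangle and 0 otherwise, fix x, y and put τ = c x − c y.
-- Inserting x or y into a (k−1)-set shows that τ sums to zero over the pairs of any (k−1)-set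
-- avoiding x and y; inserting single vertices into (k−2)- and (k−3)-sets then shows that τ is
-- constant on pairs of distinct vertices outside {x, y} (this needs n ≥ k + 3), hence zero.
-- So c x a b = c y a b for distinct x, y, a, b: a 3-cycle and a fourth vertex d would make every
-- triple through d cyclic, although d dominates, or is dominated by, two of the other three.
module Submission where

open import Defs
open import Data.Nat as ℕ using (ℕ; zero; suc; _≤_; _<_; z≤n; s≤s; _∸_)
import Data.Nat.Properties as ℕP
open import Data.Integer using (ℤ; 0ℤ; 1ℤ; -_; +_; _+_; _*_; _-_)
open import Data.Integer.Properties
  using (+-identityˡ; +-identityʳ; *-identityˡ; *-identityʳ; *-zeroˡ; *-zeroʳ; +-*-semiring;
         neg-distribˡ-*; neg-distribʳ-*; +-0-abelianGroup; neg-distrib-+; neg-involutive; neg-injective;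
         *-distribˡ-+; +-assoc; *-cancelˡ-≡; i≡j⇒i-j≡0; i-j≡0⇒i≡j; +-comm)
open import Data.Integer.Tactic.RingSolver using (solve-∀)
open import Algebra.Properties.AbelianGroup +-0-abelianGroup using () renaming (∙-cancelˡ to +-cancelˡ)
open import Algebra.Properties.Semiring.Sum +-*-semiring
  using (sum; sum-syntax; sum-cong-≗; ∑-distrib-+; ∑-comm; *-distribˡ-sum; sum-replicate-zero)
open import Data.Fin using (Fin; zero; suc; punchIn; _≟_)
open import Data.Fin.Properties using (punchInᵢ≢i; punchIn-injective; suc-injective)
open import Data.Bool using (Bool; true; false; not; if_then_else_; _∨_)
open import Data.Bool.Properties using (∨-zeroʳ)
open import Data.List using (List; []; _∷_; length)
open import Data.List.Relation.Unary.All as All using (All; []; _∷_; universal)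
open import Data.List.Relation.Unary.Any using (here; there; any?)
open import Data.List.Membership.Propositional using (_∈_; _∉_)
import Data.Vec.Functional as Vec
open import Data.Product using (Σ; _,_; _×_)
open import Data.Sum using (_⊎_; inj₁; inj₂)
open import Data.Empty using (⊥; ⊥-elim)
open import Function using (_∘_; case_of_)
open import Relation.Binary.PropositionalEquality
open import Relation.Nullary using (does; yes; no)
open import Relation.Nullary.Decidable using (dec-true)
open ≡-Reasoning

coeff-+P : ∀ p q i → coeff (p +P q) i ≡ coeff p i + coeff q i
coeff-+P []      q       i       = sym (+-identityˡ _)
coeff-+P (a ∷ p) []      i       = sym (+-identityʳ _)
coeff-+P (a ∷ p) (b ∷ q) zero    = refl
coeff-+P (a ∷ p) (b ∷ q) (suc i) = coeff-+P p q i

coeff-negP : ∀ p i → coeff (negP p) i ≡ - coeff p i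
coeff-negP []      i       = refl
coeff-negP (a ∷ p) zero    = refl
coeff-negP (a ∷ p) (suc i) = coeff-negP p i

coeff-scaleP : ∀ a p i → coeff (scaleP a p) i ≡ a * coeff p i
coeff-scaleP a []      i       = sym (*-zeroʳ a)
coeff-scaleP a (b ∷ p) zero    = refl
coeff-scaleP a (b ∷ p) (suc i) = coeff-scaleP a p i

coeff-scalar-*P : ∀ a q i → coeff ((a ∷ []) *P q) i ≡ a * coeff q i
coeff-scalar-*P a q i = begin
  coeff (scaleP a q +P (0ℤ ∷ [])) i      ≡⟨ coeff-+P (scaleP a q) (0ℤ ∷ []) i ⟩
  coeff (scaleP a q) i + coeff (0ℤ ∷ []) i ≡⟨ cong₂ _+_ (coeff-scaleP a q i) (zero-const i) ⟩
  a * coeff q i + 0ℤ                      ≡⟨ +-identityʳ _ ⟩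
  a * coeff q i                           ∎
  where
  zero-const : ∀ i → coeff (0ℤ ∷ []) i ≡ 0ℤ
  zero-const zero    = refl
  zero-const (suc i) = refl

coeff-scalar-*P-vanishes : ∀ a q i → coeff q i ≡ 0ℤ → coeff ((a ∷ []) *P q) i ≡ 0ℤ
coeff-scalar-*P-vanishes a q i q≡0 =
  trans (coeff-scalar-*P a q i) (trans (cong (a *_) q≡0) (*-zeroʳ a))

coeff-linear-*P-zero : ∀ a q → coeff ((a ∷ 1ℤ ∷ []) *P q) zero ≡ a * coeff q zero
coeff-linear-*P-zero a q =
  trans (coeff-+P (scaleP a q) _ zero) (trans (cong (_+ 0ℤ) (coeff-scaleP a q zero)) (+-identityʳ _))

coeff-linear-*P-suc : ∀ a q i →
  coeff ((a ∷ 1ℤ ∷ []) *P q) (suc i) ≡ a * coeff q (suc i) + coeff q i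
coeff-linear-*P-suc a q i = trans (coeff-+P (scaleP a q) _ (suc i))
  (cong₂ _+_ (coeff-scaleP a q (suc i)) (trans (coeff-scalar-*P 1ℤ q i) (*-identityˡ _)))

coeff-z*P-suc : ∀ a q i → a ≡ 0ℤ → coeff ((- a ∷ 1ℤ ∷ []) *P q) (suc i) ≡ coeff q i
coeff-z*P-suc .0ℤ q i refl = trans (coeff-linear-*P-suc 0ℤ q i) (+-identityˡ _)

coeff-z*P-zero : ∀ a q → a ≡ 0ℤ → coeff ((- a ∷ 1ℤ ∷ []) *P q) zero ≡ 0ℤ
coeff-z*P-zero .0ℤ q refl = coeff-linear-*P-zero 0ℤ q

sum-neg : ∀ {r} (f : Fin r → ℤ) → ∑[ j < r ] (- f j) ≡ - ∑[ j < r ] f j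
sum-neg {zero}  f = refl
sum-neg {suc r} f = trans (cong (_+_ (- f zero)) (sum-neg (f ∘ suc))) (sym (neg-distrib-+ (f zero) _))

sum-negˡ-* : ∀ {r} (s t : Fin r → ℤ) → ∑[ j < r ] ((- s j) * t j) ≡ - ∑[ j < r ] (s j * t j)
sum-negˡ-* s t =
  trans (sum-cong-≗ (λ j → sym (neg-distribˡ-* (s j) (t j)))) (sum-neg (λ j → s j * t j))

sum-zero : ∀ {r} (f : Fin r → ℤ) → (∀ j → f j ≡ 0ℤ) → sum f ≡ 0ℤ
sum-zero {r} f f≡0 = trans (sum-cong-≗ f≡0) (sum-replicate-zero r)

sign : ∀ {r} → Fin r → ℤ
sign zero    = 1ℤ
sign (suc j) = - sign j

sign*sign : ∀ {r} (j : Fin r) → sign j * sign j ≡ 1ℤ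
sign*sign zero    = refl
sign*sign (suc j) = trans (neg*neg (sign j)) (sign*sign j)
  where
  neg*neg : ∀ a → (- a) * (- a) ≡ a * a
  neg*neg = solve-∀

sum-*-vanishes : ∀ {r} (s t : Fin r → ℤ) → (∀ j → t j ≡ 0ℤ) →
  ∑[ j < r ] (s j * t j) ≡ 0ℤ
sum-*-vanishes s t t≡0 = sum-zero _ (λ j → trans (cong (s j *_) (t≡0 j)) (*-zeroʳ (s j)))

sign-cancel : ∀ {r} (j : Fin r) a x → sign j * ((- a) * (sign j * x)) ≡ - (a * x)
sign-cancel j a x = trans (reassoc (sign j) a x)
  (trans (cong (λ s → - (s * (a * x))) (sign*sign j)) (cong -_ (*-identityˡ (a * x))))
  where
  reassoc : ∀ s a x → s * ((- a) * (s * x)) ≡ - ((s * s) * (a * x))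
  reassoc = solve-∀

coeff-altSum : ∀ {r} (f : Fin r → Poly) i → coeff (altSum f) i ≡ ∑[ j < r ] (sign j * coeff (f j) i)
coeff-altSum {zero}  f i = refl
coeff-altSum {suc r} f i = begin
  coeff (f zero +P negP (altSum (f ∘ suc))) i
    ≡⟨ coeff-+P (f zero) _ i ⟩
  coeff (f zero) i + coeff (negP (altSum (f ∘ suc))) i
    ≡⟨ cong₂ _+_ (sym (*-identityˡ (coeff (f zero) i)))
                 (trans (coeff-negP (altSum (f ∘ suc)) i) (cong -_ (coeff-altSum (f ∘ suc) i))) ⟩
  1ℤ * coeff (f zero) i + - ∑[ j < r ] (sign j * coeff (f (suc j)) i)
    ≡⟨ cong (_+_ (1ℤ * coeff (f zero) i)) (sym (sum-negˡ-* sign (λ j → coeff (f (suc j)) i))) ⟩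
  ∑[ j < suc r ] (sign j * coeff (f j) i) ∎

minor : ∀ {m} {A : Set} → (Fin (suc m) → Fin (suc m) → A) → Fin (suc m) → Fin m → Fin m → A
minor X j i l = X (suc i) (punchIn j l)

coeff-det-suc : ∀ m (X : Fin (suc m) → Fin (suc m) → Poly) k →
  coeff (det (suc m) X) k ≡
  coeff (X zero zero *P det m (minor X zero)) k
    - ∑[ b < m ] (sign b * coeff (X zero (suc b) *P det m (minor X (suc b))) k)
coeff-det-suc m X k = begin
  coeff (det (suc m) X) k
    ≡⟨ coeff-altSum (λ j → X zero j *P det m (minor X j)) k ⟩
  1ℤ * t zero + ∑[ b < m ] ((- sign b) * t (suc b))
    ≡⟨ cong₂ _+_ (*-identityˡ (t zero)) (sum-negˡ-* sign (t ∘ suc)) ⟩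
  t zero - ∑[ b < m ] (sign b * t (suc b)) ∎
  where
  t : Fin (suc m) → ℤ
  t j = coeff (X zero j *P det m (minor X j)) k

det-cong : ∀ m {X Y : Fin m → Fin m → Poly} → (∀ i j → X i j ≡ Y i j) → det m X ≡ det m Y
det-cong zero    X≡Y = refl
det-cong (suc m) X≡Y =
  altSum-cong (λ j → cong₂ _*P_ (X≡Y zero j) (det-cong m (λ i l → X≡Y (suc i) (punchIn j l))))
  where
  altSum-cong : ∀ {r} {f g : Fin r → Poly} → (∀ j → f j ≡ g j) → altSum f ≡ altSum g
  altSum-cong {zero}  f≡g = refl
  altSum-cong {suc r} f≡g = cong₂ _+P_ (f≡g zero) (cong negP (altSum-cong (f≡g ∘ suc)))

count : ∀ {m} → (Fin m → Bool) → ℕ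
count {zero}  d = 0
count {suc m} d = if d zero then suc (count (d ∘ suc)) else count (d ∘ suc)

count≤ : ∀ {m} (d : Fin m → Bool) → count d ≤ m
count≤ {zero}  d = z≤n
count≤ {suc m} d with d zero
... | true  = s≤s (count≤ (d ∘ suc))
... | false = ℕP.m≤n⇒m≤1+n (count≤ (d ∘ suc))

count<-if-false : ∀ {m} (d : Fin m → Bool) r → d r ≡ false → count d < m
count<-if-false d zero    dr≡false rewrite dr≡false = s≤s (count≤ (d ∘ suc))
count<-if-false d (suc r) dr≡false with d zero
... | true  = s≤s (count<-if-false (d ∘ suc) r dr≡false)
... | false = ℕP.m≤n⇒m≤1+n (count<-if-false (d ∘ suc) r dr≡false)

count<-if-two-false : ∀ {m} (d : Fin m → Bool) r s → r ≢ s → d r ≡ false → d s ≡ false →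
  suc (count d) < m
count<-if-two-false d zero    zero    r≢s _ _ = ⊥-elim (r≢s refl)
count<-if-two-false d zero    (suc s) r≢s dr ds rewrite dr = s≤s (count<-if-false (d ∘ suc) s ds)
count<-if-two-false d (suc r) zero    r≢s dr ds rewrite ds = s≤s (count<-if-false (d ∘ suc) r dr)
count<-if-two-false d (suc r) (suc s) r≢s dr ds with d zero
... | true  = s≤s (count<-if-two-false (d ∘ suc) r s (r≢s ∘ cong suc) dr ds)
... | false = ℕP.m≤n⇒m≤1+n (count<-if-two-false (d ∘ suc) r s (r≢s ∘ cong suc) dr ds)

data Entry : Bool → Poly → Set where
  constant : ∀ {b} a → Entry b (a ∷ [])
  monic    : ∀ a → Entry true (a ∷ 1ℤ ∷ [])

coeff-*P-beyond-degree : ∀ {b e} (D : Poly) c k → Entry b e → (if b then suc c else c) < k →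
  (∀ k′ → c < k′ → coeff D k′ ≡ 0ℤ) → coeff (e *P D) k ≡ 0ℤ
coeff-*P-beyond-degree {false} D c k (constant a) c<k D-vanishes =
  coeff-scalar-*P-vanishes a D k (D-vanishes k c<k)
coeff-*P-beyond-degree {true} D c k (constant a) c<k D-vanishes =
  coeff-scalar-*P-vanishes a D k (D-vanishes k (ℕP.<-trans (ℕP.n<1+n c) c<k))
coeff-*P-beyond-degree D c (suc k) (monic a) (s≤s c<k) D-vanishes = begin
  coeff ((a ∷ 1ℤ ∷ []) *P D) (suc k)  ≡⟨ coeff-linear-*P-suc a D k ⟩
  a * coeff D (suc k) + coeff D k
    ≡⟨ cong₂ (λ u v → a * u + v) (D-vanishes (suc k) (ℕP.m<n⇒m<1+n c<k)) (D-vanishes k c<k) ⟩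
  a * 0ℤ + 0ℤ                         ≡⟨ cong (_+ 0ℤ) (*-zeroʳ a) ⟩
  0ℤ                                  ∎

coeff-det-beyond-degree : ∀ m (X : Fin m → Fin m → Poly) (d : Fin m → Bool) →
  (∀ i j → Entry (d i) (X i j)) → ∀ k → count d < k → coeff (det m X) k ≡ 0ℤ
coeff-det-beyond-degree zero    X d entry (suc k) _   = refl
coeff-det-beyond-degree (suc m) X d entry k       d<k =
  trans (coeff-altSum (λ j → X zero j *P det m (minor X j)) k) (sum-*-vanishes sign _ λ j →
    coeff-*P-beyond-degree (det m (minor X j)) (count (d ∘ suc)) k (entry zero j) d<k
      (coeff-det-beyond-degree m (minor X j) (d ∘ suc) (λ i l → entry (suc i) (punchIn j l))))

coeff-det-beyond-size : ∀ m (X : Fin m → Fin m → Poly) → (∀ i j → Entry true (X i j)) →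
  coeff (det m X) (suc m) ≡ 0ℤ
coeff-det-beyond-size m X entry = coeff-det-beyond-degree m X (λ _ → true) entry (suc m) (s≤s (count≤ _))

coeff-det-constant-row : ∀ m (X : Fin m → Fin m → Poly) (r : Fin m) →
  (∀ i j → Entry true (X i j)) → (∀ j → Entry false (X r j)) → coeff (det m X) m ≡ 0ℤ
coeff-det-constant-row m X r entry row =
  coeff-det-beyond-degree m X d entry′ m (count<-if-false d r (cong not (dec-true (r ≟ r) refl)))
  where
  d : Fin m → Bool
  d i = not (does (i ≟ r))
  entry′ : ∀ i j → Entry (d i) (X i j)
  entry′ i j with i ≟ r
  ... | yes refl = row j
  ... | no _     = entry i j

coeff-det-constant-rows : ∀ m (X : Fin (suc m) → Fin (suc m) → Poly) (r s : Fin (suc m)) → r ≢ s →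
  (∀ i j → Entry true (X i j)) → (∀ j → Entry false (X r j)) → (∀ j → Entry false (X s j)) →
  coeff (det (suc m) X) m ≡ 0ℤ
coeff-det-constant-rows m X r s r≢s entry row-r row-s =
  coeff-det-beyond-degree (suc m) X d entry′ m (ℕP.≤-pred (count<-if-two-false d r s r≢s d-r d-s))
  where
  d : Fin (suc m) → Bool
  d i = not (does (i ≟ r) ∨ does (i ≟ s))
  d-r : d r ≡ false
  d-r = cong (λ b → not (b ∨ does (r ≟ s))) (dec-true (r ≟ r) refl)
  d-s : d s ≡ false
  d-s = cong not (trans (cong (does (s ≟ r) ∨_) (dec-true (s ≟ s) refl)) (∨-zeroʳ _))
  entry′ : ∀ i j → Entry (d i) (X i j)
  entry′ i j with i ≟ r | i ≟ s
  ... | yes refl | _        = row-r j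
  ... | no _     | yes refl = row-s j
  ... | no _     | no _     = entry i j

-- The top coefficients of det(zI − M) for zero-diagonal M

charMatrix : ∀ {m} → (Fin m → Fin m → ℤ) → Fin m → Fin m → Poly
charMatrix M i j = if does (i ≟ j) then (- M i j) ∷ 1ℤ ∷ [] else (- M i j) ∷ []

charMatrix-entry : ∀ {m} (M : Fin m → Fin m → ℤ) i j → Entry true (charMatrix M i j)
charMatrix-entry M i j with does (i ≟ j)
... | true  = monic _
... | false = constant _

charMatrix-offDiagonal : ∀ {m} (M : Fin m → Fin m → ℤ) i j → i ≢ j →
  Entry false (charMatrix M i j)
charMatrix-offDiagonal M i j i≢j with i ≟ j
... | yes i≡j = ⊥-elim (i≢j i≡j)
... | no _    = constant _

charMatrix-minor-constant-row : ∀ {m} (M : Fin (suc m) → Fin (suc m) → ℤ) (b l : Fin m) →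
  Entry false (minor (charMatrix M) (suc b) b l)
charMatrix-minor-constant-row M b l =
  charMatrix-offDiagonal M (suc b) (punchIn (suc b) l) (λ e → punchInᵢ≢i (suc b) l (sym e))

ZeroDiagonal : ∀ {m} → (Fin m → Fin m → ℤ) → Set
ZeroDiagonal M = ∀ i → M i i ≡ 0ℤ

_↓ : ∀ {m} {A : Set} → (Fin (suc m) → Fin (suc m) → A) → Fin m → Fin m → A
(M ↓) i j = M (suc i) (suc j)

↓-zeroDiagonal : ∀ {m} (M : Fin (suc m) → Fin (suc m) → ℤ) → ZeroDiagonal M → ZeroDiagonal (M ↓)
↓-zeroDiagonal M zd i = zd (suc i)

coeff-charPoly-lead : ∀ m (M : Fin m → Fin m → ℤ) → ZeroDiagonal M →
  coeff (det m (charMatrix M)) m ≡ 1ℤ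
coeff-charPoly-lead zero    M zd = refl
coeff-charPoly-lead (suc m) M zd =
  trans (coeff-det-suc m (charMatrix M) (suc m)) (cong₂ _-_ diagonal others)
  where
  diagonal : coeff (charMatrix M zero zero *P det m (charMatrix (M ↓))) (suc m) ≡ 1ℤ
  diagonal = trans (coeff-z*P-suc (M zero zero) (det m (charMatrix (M ↓))) m (zd zero))
    (coeff-charPoly-lead m (M ↓) (↓-zeroDiagonal M zd))
  others : ∑[ b < m ] (sign b * coeff (charMatrix M zero (suc b) *P det m (minor (charMatrix M) (suc b))) (suc m))
           ≡ 0ℤ
  others = sum-*-vanishes sign _ λ b →
    coeff-scalar-*P-vanishes (- M zero (suc b)) (det m (minor (charMatrix M) (suc b))) (suc m)
      (coeff-det-beyond-size m (minor (charMatrix M) (suc b))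
        (λ i l → charMatrix-entry M (suc i) (punchIn (suc b) l)))

coeff-charPoly-trace : ∀ m (M : Fin (suc m) → Fin (suc m) → ℤ) → ZeroDiagonal M →
  coeff (det (suc m) (charMatrix M)) m ≡ 0ℤ
coeff-charPoly-trace m M zd =
  trans (coeff-det-suc m (charMatrix M) m) (cong₂ _-_ (diagonal m M zd) others)
  where
  diagonal : ∀ m (M : Fin (suc m) → Fin (suc m) → ℤ) → ZeroDiagonal M →
    coeff (charMatrix M zero zero *P det m (charMatrix (M ↓))) m ≡ 0ℤ
  diagonal zero    M zd = coeff-z*P-zero (M zero zero) (det zero (charMatrix (M ↓))) (zd zero)
  diagonal (suc m) M zd = trans (coeff-z*P-suc (M zero zero) (det (suc m) (charMatrix (M ↓))) m (zd zero))
    (coeff-charPoly-trace m (M ↓) (↓-zeroDiagonal M zd))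
  others : ∑[ b < m ] (sign b * coeff (charMatrix M zero (suc b) *P det m (minor (charMatrix M) (suc b))) m)
           ≡ 0ℤ
  others = sum-*-vanishes sign _ λ b →
    coeff-scalar-*P-vanishes (- M zero (suc b)) (det m (minor (charMatrix M) (suc b))) m
      (coeff-det-constant-row m (minor (charMatrix M) (suc b)) b
        (λ i l → charMatrix-entry M (suc i) (punchIn (suc b) l)) (charMatrix-minor-constant-row M b))

-- det withColumn M b w is det(zI − M) with column b replaced by w, up to the sign of moving
-- that column to the front.
withColumn : ∀ {p} → (Fin (suc p) → Fin (suc p) → ℤ) → Fin (suc p) → (Fin (suc p) → ℤ) →
  Fin (suc p) → Fin (suc p) → Poly
withColumn M b w i zero    = w i ∷ []
withColumn M b w i (suc l) = charMatrix M i (punchIn b l)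

withColumn-entry : ∀ {p} (M : Fin (suc p) → Fin (suc p) → ℤ) b w i l →
  Entry true (withColumn M b w i l)
withColumn-entry M b w i zero    = constant _
withColumn-entry M b w i (suc l) = charMatrix-entry M i (punchIn b l)

coeff-withColumn-lead : ∀ p (M : Fin (suc p) → Fin (suc p) → ℤ) b w → ZeroDiagonal M →
  coeff (det (suc p) (withColumn M b w)) p ≡ sign b * w b
coeff-withColumn-lead p M zero w zd =
  trans (coeff-det-suc p X p)
    (trans (cong₂ _-_ first others) (trans (+-identityʳ (w zero)) (sym (*-identityˡ (w zero)))))
  where
  X = withColumn M zero w
  first : coeff ((w zero ∷ []) *P det p (charMatrix (M ↓))) p ≡ w zero
  first = trans (coeff-scalar-*P (w zero) (det p (charMatrix (M ↓))) p)
    (trans (cong (w zero *_) (coeff-charPoly-lead p (M ↓) (↓-zeroDiagonal M zd))) (*-identityʳ _))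
  row-l : ∀ l j → Entry false (minor X (suc l) l j)
  row-l l zero    = constant _
  row-l l (suc y) =
    charMatrix-offDiagonal M (suc l) (suc (punchIn l y)) (λ e → punchInᵢ≢i l y (sym (suc-injective e)))
  others : ∑[ l < p ] (sign l * coeff (X zero (suc l) *P det p (minor X (suc l))) p) ≡ 0ℤ
  others = sum-*-vanishes sign _ λ l →
    coeff-scalar-*P-vanishes (- M zero (suc l)) (det p (minor X (suc l))) p
      (coeff-det-constant-row p (minor X (suc l)) l
        (λ i j → withColumn-entry M zero w (suc i) (punchIn (suc l) j)) (row-l l))
coeff-withColumn-lead (suc p) M (suc b) w zd =
  trans (coeff-det-suc (suc p) X (suc p))
    (trans (cong₂ _-_ first (cong₂ _+_ (cong (1ℤ *_) second) others)) (arith (sign b) (w (suc b))))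
  where
  X = withColumn M (suc b) w
  first : coeff ((w zero ∷ []) *P det (suc p) (minor (charMatrix M) (suc b))) (suc p) ≡ 0ℤ
  first = coeff-scalar-*P-vanishes (w zero) (det (suc p) (minor (charMatrix M) (suc b))) (suc p)
    (coeff-det-constant-row (suc p) (minor (charMatrix M) (suc b)) b
      (λ i l → charMatrix-entry M (suc i) (punchIn (suc b) l)) (charMatrix-minor-constant-row M b))
  minor₁ : ∀ i l → minor X (suc zero) i l ≡ withColumn (M ↓) b (w ∘ suc) i l
  minor₁ i zero    = refl
  minor₁ i (suc y) = refl
  second : coeff (X zero (suc zero) *P det (suc p) (minor X (suc zero))) (suc p) ≡ sign b * w (suc b)
  second = trans (coeff-z*P-suc (M zero zero) (det (suc p) (minor X (suc zero))) p (zd zero))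
    (trans (cong (λ q → coeff q p) (det-cong (suc p) minor₁))
      (coeff-withColumn-lead p (M ↓) b (w ∘ suc) (↓-zeroDiagonal M zd)))
  row-b : ∀ x l → Entry false (minor X (suc (suc x)) b l)
  row-b x zero    = constant _
  row-b x (suc y) = charMatrix-offDiagonal M (suc b) (punchIn (suc b) (punchIn (suc x) y))
    (λ e → punchInᵢ≢i (suc b) (punchIn (suc x) y) (sym e))
  others : ∑[ x < p ] ((- sign x) * coeff (X zero (suc (suc x)) *P det (suc p) (minor X (suc (suc x)))) (suc p))
           ≡ 0ℤ
  others = sum-*-vanishes (λ x → - sign x) _ λ x →
    coeff-scalar-*P-vanishes (- M zero (suc (punchIn b x))) (det (suc p) (minor X (suc (suc x)))) (suc p)
      (coeff-det-constant-row (suc p) (minor X (suc (suc x))) b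
        (λ i l → withColumn-entry M (suc b) w (suc i) (punchIn (suc (suc x)) l)) (row-b x))
  arith : ∀ s t → 0ℤ - (1ℤ * (s * t) + 0ℤ) ≡ (- s) * t
  arith = solve-∀

coeff-withColumn-next : ∀ p (M : Fin (suc (suc p)) → Fin (suc (suc p)) → ℤ) b w → ZeroDiagonal M →
  coeff (det (suc (suc p)) (withColumn M b w)) p ≡ sign b * ∑[ j < suc (suc p) ] (M b j * w j)

coeff-withColumn-diagonal-term : ∀ p (M : Fin (suc (suc p)) → Fin (suc (suc p)) → ℤ) b w →
  ZeroDiagonal M →
  coeff (withColumn M (suc b) w zero (suc zero) *P det (suc p) (minor (withColumn M (suc b) w) (suc zero))) p
  ≡ sign b * ∑[ j < suc p ] (M (suc b) (suc j) * w (suc j))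

coeff-withColumn-next p M zero w zd =
  trans (coeff-det-suc (suc p) X p)
    (trans (cong₂ _-_ first others) (arith (M zero zero) (w zero) S (zd zero)))
  where
  X = withColumn M zero w
  S = ∑[ l < suc p ] (M zero (suc l) * w (suc l))
  first : coeff ((w zero ∷ []) *P det (suc p) (charMatrix (M ↓))) p ≡ 0ℤ
  first = coeff-scalar-*P-vanishes (w zero) (det (suc p) (charMatrix (M ↓))) p
    (coeff-charPoly-trace p (M ↓) (↓-zeroDiagonal M zd))
  minorₗ : ∀ l i l′ → minor X (suc l) i l′ ≡ withColumn (M ↓) l (w ∘ suc) i l′
  minorₗ l i zero    = refl
  minorₗ l i (suc y) = refl
  term : ∀ l → coeff (X zero (suc l) *P det (suc p) (minor X (suc l))) p
               ≡ (- M zero (suc l)) * (sign l * w (suc l))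
  term l = trans (coeff-scalar-*P (- M zero (suc l)) (det (suc p) (minor X (suc l))) p)
    (cong ((- M zero (suc l)) *_) (trans (cong (λ q → coeff q p) (det-cong (suc p) (minorₗ l)))
      (coeff-withColumn-lead p (M ↓) l (w ∘ suc) (↓-zeroDiagonal M zd))))
  others : ∑[ l < suc p ] (sign l * coeff (X zero (suc l) *P det (suc p) (minor X (suc l))) p) ≡ - S
  others = trans
    (sum-cong-≗ (λ l → trans (cong (sign l *_) (term l)) (sign-cancel l (M zero (suc l)) (w (suc l)))))
    (sum-neg (λ l → M zero (suc l) * w (suc l)))
  arith : ∀ m₀₀ w₀ S → m₀₀ ≡ 0ℤ → 0ℤ - (- S) ≡ 1ℤ * (m₀₀ * w₀ + S)
  arith .0ℤ w₀ S refl = lemma w₀ S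
    where
    lemma : ∀ w₀ S → 0ℤ - (- S) ≡ 1ℤ * (0ℤ * w₀ + S)
    lemma = solve-∀
coeff-withColumn-next p M (suc b) w zd =
  trans (coeff-det-suc (suc p) X p)
    (trans (cong₂ _-_ first (cong₂ _+_ (cong (1ℤ *_) (coeff-withColumn-diagonal-term p M b w zd)) others))
      (arith (w zero) (sign b) (M (suc b) zero) S))
  where
  X = withColumn M (suc b) w
  S = ∑[ j < suc p ] (M (suc b) (suc j) * w (suc j))
  minor₀ : ∀ i l → minor X zero i l ≡ withColumn (M ↓) b (λ i → - M (suc i) zero) i l
  minor₀ i zero    = refl
  minor₀ i (suc y) = refl
  first : coeff ((w zero ∷ []) *P det (suc p) (minor X zero)) p ≡ w zero * (sign b * (- M (suc b) zero))
  first = trans (coeff-scalar-*P (w zero) (det (suc p) (minor X zero)) p)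
    (cong (w zero *_) (trans (cong (λ q → coeff q p) (det-cong (suc p) minor₀))
      (coeff-withColumn-lead p (M ↓) b (λ i → - M (suc i) zero) (↓-zeroDiagonal M zd))))
  D : Fin p → Fin (suc p) → Fin (suc p) → Poly
  D x = minor X (suc (suc x))
  row-b : ∀ x l → Entry false (D x b l)
  row-b x zero    = constant _
  row-b x (suc y) = charMatrix-offDiagonal M (suc b) (punchIn (suc b) (punchIn (suc x) y))
    (λ e → punchInᵢ≢i (suc b) (punchIn (suc x) y) (sym e))
  row-bx : ∀ x l → Entry false (D x (punchIn b x) l)
  row-bx x zero    = constant _
  row-bx x (suc y) = charMatrix-offDiagonal M (suc (punchIn b x)) (punchIn (suc b) (punchIn (suc x) y))
    (λ e → punchInᵢ≢i (suc x) y (sym (punchIn-injective (suc b) (suc x) (punchIn (suc x) y) e)))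
  others : ∑[ x < p ] ((- sign x) * coeff (X zero (suc (suc x)) *P det (suc p) (D x)) p) ≡ 0ℤ
  others = sum-*-vanishes (λ x → - sign x) _ λ x →
    coeff-scalar-*P-vanishes (- M zero (suc (punchIn b x))) (det (suc p) (D x)) p
      (coeff-det-constant-rows p (D x) b (punchIn b x) (λ e → punchInᵢ≢i b x (sym e))
        (λ i l → withColumn-entry M (suc b) w (suc i) (punchIn (suc (suc x)) l)) (row-b x) (row-bx x))
  arith : ∀ w₀ s m S → w₀ * (s * (- m)) - (1ℤ * (s * S) + 0ℤ) ≡ (- s) * (m * w₀ + S)
  arith = solve-∀

coeff-withColumn-diagonal-term zero M zero w zd =
  trans (coeff-z*P-zero (M zero zero) (det 1 (minor (withColumn M (suc zero) w) (suc zero))) (zd zero))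
    (sym (cong (λ t → 1ℤ * (t * w (suc zero) + 0ℤ)) (zd (suc zero))))
coeff-withColumn-diagonal-term (suc p) M b w zd =
  trans (coeff-z*P-suc (M zero zero) (det (suc (suc p)) (minor (withColumn M (suc b) w) (suc zero))) p
                       (zd zero))
    (trans (cong (λ q → coeff q p) (det-cong (suc (suc p)) minor₁))
      (coeff-withColumn-next p (M ↓) b (w ∘ suc) (↓-zeroDiagonal M zd)))
  where
  minor₁ : ∀ i l →
    minor (withColumn M (suc b) w) (suc zero) i l ≡ withColumn (M ↓) b (w ∘ suc) i l
  minor₁ i zero    = refl
  minor₁ i (suc y) = refl

-- ∑ over i < j, i < l of M i j M j l M l i: each 3-cycle of a digraph is counted once,
-- from its least vertex.
threeCycles : ∀ {n} → (Fin n → Fin n → ℤ) → ℤ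
threeCycles {zero}  M = 0ℤ
threeCycles {suc n} M =
  threeCycles (M ↓) + ∑[ j < n ] ∑[ l < n ] (M zero (suc j) * M (suc j) (suc l) * M (suc l) zero)

threeCycles-2 : ∀ (M : Fin 2 → Fin 2 → ℤ) → ZeroDiagonal M → threeCycles M ≡ 0ℤ
threeCycles-2 M zd =
  trans (cong (λ t → 0ℤ + 0ℤ + (M zero (suc zero) * t * M (suc zero) zero + 0ℤ + 0ℤ)) (zd (suc zero)))
    (arith (M zero (suc zero)) (M (suc zero) zero))
  where
  arith : ∀ a b → 0ℤ + 0ℤ + (a * 0ℤ * b + 0ℤ + 0ℤ) ≡ 0ℤ
  arith = solve-∀

coeff-charPoly-cubic : ∀ m (M : Fin (3 ℕ.+ m) → Fin (3 ℕ.+ m) → ℤ) → ZeroDiagonal M →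
  coeff (det (3 ℕ.+ m) (charMatrix M)) m ≡ - threeCycles M
coeff-charPoly-cubic m M zd =
  trans (coeff-det-suc (2 ℕ.+ m) (charMatrix M) m)
    (trans (cong₂ _-_ (diagonal m M zd) others) (arith (threeCycles (M ↓)) (sum T)))
  where
  diagonal : ∀ m (M : Fin (3 ℕ.+ m) → Fin (3 ℕ.+ m) → ℤ) → ZeroDiagonal M →
    coeff (charMatrix M zero zero *P det (2 ℕ.+ m) (charMatrix (M ↓))) m ≡ - threeCycles (M ↓)
  diagonal zero    M zd = trans (coeff-z*P-zero (M zero zero) (det 2 (charMatrix (M ↓))) (zd zero))
    (sym (cong -_ (threeCycles-2 (M ↓) (↓-zeroDiagonal M zd))))
  diagonal (suc m) M zd =
    trans (coeff-z*P-suc (M zero zero) (det (3 ℕ.+ m) (charMatrix (M ↓))) m (zd zero))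
      (coeff-charPoly-cubic m (M ↓) (↓-zeroDiagonal M zd))
  v : Fin (2 ℕ.+ m) → ℤ
  v i = - M (suc i) zero
  T : Fin (2 ℕ.+ m) → ℤ
  T b = ∑[ l < 2 ℕ.+ m ] (M zero (suc b) * M (suc b) (suc l) * M (suc l) zero)
  minorᵦ : ∀ b i l → minor (charMatrix M) (suc b) i l ≡ withColumn (M ↓) b v i l
  minorᵦ b i zero    = refl
  minorᵦ b i (suc y) = refl
  paths : ∀ b → M zero (suc b) * ∑[ j < 2 ℕ.+ m ] ((M ↓) b j * v j) ≡ - T b
  paths b = trans (*-distribˡ-sum (M zero (suc b)) (λ j → (M ↓) b j * v j))
    (trans (sum-cong-≗ (λ l → arith′ (M zero (suc b)) (M (suc b) (suc l)) (M (suc l) zero)))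
      (sum-neg (λ l → M zero (suc b) * M (suc b) (suc l) * M (suc l) zero)))
    where
    arith′ : ∀ x y u → x * (y * (- u)) ≡ - (x * y * u)
    arith′ = solve-∀
  D : Fin (2 ℕ.+ m) → Poly
  D b = det (2 ℕ.+ m) (minor (charMatrix M) (suc b))
  term : ∀ b → sign b * coeff (charMatrix M zero (suc b) *P D b) m ≡ T b
  term b = begin
    sign b * coeff ((- M zero (suc b) ∷ []) *P D b) m
      ≡⟨ cong (sign b *_) (coeff-scalar-*P (- M zero (suc b)) (D b) m) ⟩
    sign b * ((- M zero (suc b)) * coeff (D b) m)
      ≡⟨ cong (λ q → sign b * ((- M zero (suc b)) * coeff q m)) (det-cong (2 ℕ.+ m) (minorᵦ b)) ⟩
    sign b * ((- M zero (suc b)) * coeff (det (2 ℕ.+ m) (withColumn (M ↓) b v)) m)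
      ≡⟨ cong (λ t → sign b * ((- M zero (suc b)) * t))
              (coeff-withColumn-next m (M ↓) b v (↓-zeroDiagonal M zd)) ⟩
    sign b * ((- M zero (suc b)) * (sign b * ∑[ j < 2 ℕ.+ m ] ((M ↓) b j * v j)))
      ≡⟨ sign-cancel b (M zero (suc b)) _ ⟩
    - (M zero (suc b) * ∑[ j < 2 ℕ.+ m ] ((M ↓) b j * v j))
      ≡⟨ cong -_ (paths b) ⟩
    - - T b
      ≡⟨ neg-involutive (T b) ⟩
    T b ∎
  others : ∑[ b < 2 ℕ.+ m ] (sign b * coeff (charMatrix M zero (suc b) *P D b) m) ≡ sum T
  others = sum-cong-≗ term
  arith : ∀ c t → - c - t ≡ - (c + t)
  arith = solve-∀

-- Symmetric 3-forms and cyclic triangles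

record SymmetricForm₃ {n} (c : Fin n → Fin n → Fin n → ℤ) : Set where
  field
    swap₁₂   : ∀ u v w → c u v w ≡ c v u w
    swap₂₃   : ∀ u v w → c u v w ≡ c u w v
    repeated : ∀ u w → c u u w ≡ 0ℤ

  repeated₁₃ : ∀ u v → c u v u ≡ 0ℤ
  repeated₁₃ u v = trans (swap₂₃ u v u) (repeated u v)

  repeated₂₃ : ∀ u v → c u v v ≡ 0ℤ
  repeated₂₃ u v = trans (swap₁₂ u v v) (repeated₁₃ v u)

  rotate : ∀ u v w → c u v w ≡ c w u v
  rotate u v w = trans (swap₂₃ u v w) (swap₁₂ u w v)

sum³ : ∀ {n} → (Fin n → Fin n → Fin n → ℤ) → ℤ
sum³ {n} c = ∑[ i < n ] ∑[ j < n ] ∑[ l < n ] c i j l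

sum³-suc : ∀ {n} (c : Fin (suc n) → Fin (suc n) → Fin (suc n) → ℤ) → SymmetricForm₃ c →
  sum³ c ≡ sum³ (λ i j l → c (suc i) (suc j) (suc l))
           + (+ 3) * ∑[ j < n ] ∑[ l < n ] c zero (suc j) (suc l)
sum³-suc {n} c sym₃ =
  trans (cong₂ _+_ first-layer (trans (sum-cong-≗ layer) (trans (∑-distrib-+ B (λ i → B i + R i))
    (cong (_+_ (sum B)) (∑-distrib-+ B R)))))
  (arith (sum B) (sum R))
  where
  open SymmetricForm₃ sym₃
  B R : Fin n → ℤ
  B i = ∑[ l < n ] c zero (suc i) (suc l)
  R i = ∑[ j < n ] ∑[ l < n ] c (suc i) (suc j) (suc l)
  first-layer : (c zero zero zero + ∑[ l < n ] c zero zero (suc l)) + ∑[ j < n ] (c zero (suc j) zero + B j)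
                ≡ sum B
  first-layer = trans
    (cong₂ _+_ (cong₂ _+_ (repeated zero zero) (sum-zero _ (λ l → repeated zero (suc l))))
               (sum-cong-≗ (λ j → trans (cong (_+ B j) (repeated₁₃ zero (suc j))) (+-identityˡ (B j)))))
    (+-identityˡ (sum B))
  layer : ∀ i → (c (suc i) zero zero + ∑[ l < n ] c (suc i) zero (suc l))
                + ∑[ j < n ] (c (suc i) (suc j) zero + ∑[ l < n ] c (suc i) (suc j) (suc l))
                ≡ B i + (B i + R i)
  layer i = cong₂ _+_
    (trans (cong (_+ ∑[ l < n ] c (suc i) zero (suc l)) (repeated₂₃ (suc i) zero))
      (trans (+-identityˡ _) (sum-cong-≗ (λ l → swap₁₂ (suc i) zero (suc l)))))
    (trans (sum-cong-≗ (λ j → cong (_+ ∑[ l < n ] c (suc i) (suc j) (suc l)) (rotate (suc i) (suc j) zero)))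
      (∑-distrib-+ (λ j → c zero (suc i) (suc j)) (λ j → ∑[ l < n ] c (suc i) (suc j) (suc l))))
  arith : ∀ b r → b + (b + (b + r)) ≡ r + (+ 3) * b
  arith = solve-∀

cyclic : ∀ {n} → (Fin n → Fin n → ℤ) → Fin n → Fin n → Fin n → ℤ
cyclic M i j l = M i j * M j l * M l i + M i l * M l j * M j i

cyclic-symmetric : ∀ {n} (M : Fin n → Fin n → ℤ) → ZeroDiagonal M → SymmetricForm₃ (cyclic M)
cyclic-symmetric M zd = record
  { swap₁₂   = λ u v w → rearrange (M u v) (M v w) (M w u) (M u w) (M w v) (M v u)
  ; swap₂₃   = λ u v w → +-comm (M u v * M v w * M w u) (M u w * M w v * M v u)
  ; repeated = λ u w → trans (cong₂ (λ a b → a * M u w * M w u + M u w * M w u * b) (zd u) (zd u))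
                             (vanish (M u w) (M w u))
  }
  where
  rearrange : ∀ uv vw wu uw wv vu → uv * vw * wu + uw * wv * vu ≡ vu * uw * wv + vw * wu * uv
  rearrange = solve-∀
  vanish : ∀ a b → 0ℤ * a * b + a * b * 0ℤ ≡ 0ℤ
  vanish = solve-∀

sum³-cyclic : ∀ {n} (M : Fin n → Fin n → ℤ) → ZeroDiagonal M →
  sum³ (cyclic M) ≡ (+ 6) * threeCycles M
sum³-cyclic {zero}  M zd = refl
sum³-cyclic {suc n} M zd = begin
  sum³ (cyclic M)
    ≡⟨ sum³-suc (cyclic M) (cyclic-symmetric M zd) ⟩
  sum³ (cyclic (M ↓)) + (+ 3) * ∑[ j < n ] ∑[ l < n ] (P j l + P l j)
    ≡⟨ cong₂ (λ a b → a + (+ 3) * b) (sum³-cyclic (M ↓) (↓-zeroDiagonal M zd)) two-orientations ⟩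
  (+ 6) * threeCycles (M ↓) + (+ 3) * (T + T)
    ≡⟨ arith (threeCycles (M ↓)) T ⟩
  (+ 6) * threeCycles M ∎
  where
  P : Fin n → Fin n → ℤ
  P j l = M zero (suc j) * M (suc j) (suc l) * M (suc l) zero
  T = ∑[ j < n ] ∑[ l < n ] P j l
  two-orientations : ∑[ j < n ] ∑[ l < n ] (P j l + P l j) ≡ T + T
  two-orientations = trans (sum-cong-≗ (λ j → ∑-distrib-+ (P j) (λ l → P l j)))
    (trans (∑-distrib-+ (λ j → ∑[ l < n ] P j l) (λ j → ∑[ l < n ] P l j))
      (cong (_+_ T) (sym (∑-comm P))))
  arith : ∀ c t → (+ 6) * c + (+ 3) * (t + t) ≡ (+ 6) * (c + t)
  arith = solve-∀

-- Subsets of Fin n as Boolean vectors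

⟦_⟧ : ∀ {n} → (Fin n → Bool) → Fin n → ℤ
⟦ s ⟧ u = if s u then 1ℤ else 0ℤ

infix 7 _·_
_·_ : ∀ {n} → (Fin n → ℤ) → (Fin n → ℤ) → ℤ
_·_ {n} r h = ∑[ w < n ] (r w * h w)

·-congʳ : ∀ {n} (r : Fin n → ℤ) {h h′ : Fin n → ℤ} → (∀ u → h u ≡ h′ u) →
  r · h ≡ r · h′
·-congʳ r h≡h′ = sum-cong-≗ (λ u → cong (r u *_) (h≡h′ u))

·-distribˡ-+ : ∀ {n} (r h₁ h₂ : Fin n → ℤ) → r · (λ u → h₁ u + h₂ u) ≡ r · h₁ + r · h₂
·-distribˡ-+ r h₁ h₂ = trans (sum-cong-≗ (λ u → *-distribˡ-+ (r u) (h₁ u) (h₂ u)))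
  (∑-distrib-+ (λ u → r u * h₁ u) (λ u → r u * h₂ u))

·-distribˡ-- : ∀ {n} (r h₁ h₂ : Fin n → ℤ) → r · (λ u → h₁ u - h₂ u) ≡ r · h₁ - r · h₂
·-distribˡ-- r h₁ h₂ = trans (·-distribˡ-+ r h₁ (λ u → - h₂ u)) (cong (_+_ (r · h₁))
  (trans (sum-cong-≗ (λ u → sym (neg-distribʳ-* (r u) (h₂ u)))) (sum-neg (λ u → r u * h₂ u))))

·-constant-on : ∀ {n} (s : Fin n → Bool) (h : Fin n → ℤ) t → (∀ w → s w ≡ true → h w ≡ t) →
  ⟦ s ⟧ · h ≡ + count s * t
·-constant-on {zero}  s h t h≡t = refl
·-constant-on {suc n} s h t h≡t with s zero in s₀
... | true  = trans
  (cong₂ _+_ (trans (*-identityˡ (h zero)) (h≡t zero s₀))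
             (·-constant-on (s ∘ suc) (h ∘ suc) t (h≡t ∘ suc)))
  (arith (+ count (s ∘ suc)) t)
  where
  arith : ∀ c t → t + c * t ≡ (1ℤ + c) * t
  arith = solve-∀
... | false =
  trans (cong₂ _+_ (*-zeroˡ (h zero)) (·-constant-on (s ∘ suc) (h ∘ suc) t (h≡t ∘ suc))) (+-identityˡ _)

·-constant-except : ∀ {n} (s : Fin n → Bool) (h : Fin n → ℤ) t v → s v ≡ true → h v ≡ 0ℤ →
  (∀ w → s w ≡ true → w ≢ v → h w ≡ t) → ⟦ s ⟧ · h + t ≡ + count s * t
·-constant-except {suc n} s h t zero s₀ h₀ h≡t rewrite s₀ = begin
  1ℤ * h zero + R + t                  ≡⟨ cong (λ a → 1ℤ * a + R + t) h₀ ⟩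
  1ℤ * 0ℤ + R + t                      ≡⟨ cong (λ r → 1ℤ * 0ℤ + r + t) R≡ ⟩
  1ℤ * 0ℤ + + count (s ∘ suc) * t + t  ≡⟨ arith (+ count (s ∘ suc)) t ⟩
  + suc (count (s ∘ suc)) * t          ∎
  where
  R = ⟦ s ∘ suc ⟧ · (h ∘ suc)
  R≡ : R ≡ + count (s ∘ suc) * t
  R≡ = ·-constant-on (s ∘ suc) (h ∘ suc) t (λ w sw → h≡t (suc w) sw (λ ()))
  arith : ∀ c t → 1ℤ * 0ℤ + c * t + t ≡ (1ℤ + c) * t
  arith = solve-∀
·-constant-except {suc n} s h t (suc v) sv hv h≡t with s zero in s₀
... | true  = begin
  1ℤ * h zero + R + t             ≡⟨ cong (λ a → 1ℤ * a + R + t) (h≡t zero s₀ (λ ())) ⟩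
  1ℤ * t + R + t                  ≡⟨ +-assoc (1ℤ * t) R t ⟩
  1ℤ * t + (R + t)                ≡⟨ cong (_+_ (1ℤ * t)) R+t≡ ⟩
  1ℤ * t + + count (s ∘ suc) * t  ≡⟨ arith (+ count (s ∘ suc)) t ⟩
  + suc (count (s ∘ suc)) * t     ∎
  where
  R = ⟦ s ∘ suc ⟧ · (h ∘ suc)
  R+t≡ : R + t ≡ + count (s ∘ suc) * t
  R+t≡ = ·-constant-except (s ∘ suc) (h ∘ suc) t v sv hv
    (λ w sw w≢v → h≡t (suc w) sw (w≢v ∘ suc-injective))
  arith : ∀ c t → 1ℤ * t + c * t ≡ (1ℤ + c) * t
  arith = solve-∀
... | false = trans (+-assoc (0ℤ * h zero) (⟦ s ∘ suc ⟧ · (h ∘ suc)) t) (trans (+-identityˡ _)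
  (·-constant-except (s ∘ suc) (h ∘ suc) t v sv hv
    (λ w sw w≢v → h≡t (suc w) sw (w≢v ∘ suc-injective))))

insert : ∀ {n} → Fin n → (Fin n → Bool) → Fin n → Bool
insert x s u = if does (u ≟ x) then true else s u

·-insert : ∀ {n} (s : Fin n → Bool) x (h : Fin n → ℤ) → s x ≡ false →
  ⟦ insert x s ⟧ · h ≡ ⟦ s ⟧ · h + h x
·-insert s zero h s₀ = begin
  1ℤ * h zero + R                   ≡⟨ arith (h zero) R ⟩
  0ℤ * h zero + R + h zero
    ≡⟨ cong (λ b → (if b then 1ℤ else 0ℤ) * h zero + R + h zero) (sym s₀) ⟩
  ⟦ s ⟧ zero * h zero + R + h zero  ∎
  where
  R = ⟦ s ∘ suc ⟧ · (h ∘ suc)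
  arith : ∀ a r → 1ℤ * a + r ≡ 0ℤ * a + r + a
  arith = solve-∀
·-insert s (suc x) h sx =
  trans (cong (_+_ (⟦ s ⟧ zero * h zero)) (·-insert (s ∘ suc) x (h ∘ suc) sx))
    (sym (+-assoc (⟦ s ⟧ zero * h zero) _ (h (suc x))))

count-insert : ∀ {n} (s : Fin n → Bool) x → s x ≡ false → count (insert x s) ≡ suc (count s)
count-insert s zero    s₀ rewrite s₀ = refl
count-insert s (suc x) sx with s zero
... | true  = cong suc (count-insert (s ∘ suc) x sx)
... | false = count-insert (s ∘ suc) x sx

insert-∉ : ∀ {n} (s : Fin n → Bool) x u → s u ≡ false → u ≢ x → insert x s u ≡ false
insert-∉ s x u su u≢x with u ≟ x
... | yes u≡x = ⊥-elim (u≢x u≡x)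
... | no _    = su

enumerate : ∀ {n} (s : Fin n → Bool) → Σ (Fin (count s) → Fin n) λ f →
  StrictlyIncreasing f × (∀ h → ∑[ i < count s ] h (f i) ≡ ⟦ s ⟧ · h)
enumerate {zero}  s = (λ ()) , (λ ()) , (λ h → refl)
enumerate {suc n} s with s zero | enumerate (s ∘ suc)
... | true  | f , f-increasing , f-sum =
  f′ , f′-increasing , λ h → cong₂ _+_ (sym (*-identityˡ (h zero))) (f-sum (h ∘ suc))
  where
  f′ : Fin (suc (count (s ∘ suc))) → Fin (suc n)
  f′ zero    = zero
  f′ (suc i) = suc (f i)
  f′-increasing : StrictlyIncreasing f′
  f′-increasing zero    (suc j) _         = s≤s z≤n
  f′-increasing (suc i) (suc j) (s≤s i<j) = s≤s (f-increasing i j i<j)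
... | false | f , f-increasing , f-sum =
  suc ∘ f , (λ i j i<j → s≤s (f-increasing i j i<j)) ,
  λ h → trans (f-sum (h ∘ suc)) (sym (+-identityˡ _))

member : ∀ {n m} (s : Fin n → Bool) → count s ≡ suc m → Σ (Fin n) λ d → s d ≡ true
member {suc n} s cs with s zero in s₀
... | true  = zero , s₀
... | false = let d , sd = member (s ∘ suc) cs in suc d , sd

member-≢ : ∀ {n} (s : Fin n → Bool) {u w} → s u ≡ false → s w ≡ true → w ≢ u
member-≢ s su sw refl with trans (sym su) sw
... | ()

Avoids : ∀ {n} → (Fin n → Bool) → List (Fin n) → Set
Avoids s = All (λ u → s u ≡ false)

shift : ∀ {n} → List (Fin (suc n)) → List (Fin n)
shift []          = []
shift (zero ∷ L)  = shift L
shift (suc u ∷ L) = u ∷ shift L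

length-shift : ∀ {n} (L : List (Fin (suc n))) → length (shift L) ≤ length L
length-shift []          = z≤n
length-shift (zero ∷ L)  = ℕP.m≤n⇒m≤1+n (length-shift L)
length-shift (suc u ∷ L) = s≤s (length-shift L)

length-shift-∈ : ∀ {n} (L : List (Fin (suc n))) → zero ∈ L → length (shift L) < length L
length-shift-∈ (zero ∷ L)  (here refl) = s≤s (length-shift L)
length-shift-∈ (zero ∷ L)  (there z∈L) = ℕP.m≤n⇒m≤1+n (length-shift-∈ L z∈L)
length-shift-∈ (suc u ∷ L) (there z∈L) = s≤s (length-shift-∈ L z∈L)

avoids-false : ∀ {n} (s : Fin n → Bool) (L : List (Fin (suc n))) →
  Avoids s (shift L) → Avoids (false Vec.∷ s) L
avoids-false s []          _               = []
avoids-false s (zero ∷ L)  s-avoids        = refl ∷ avoids-false s L s-avoids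
avoids-false s (suc u ∷ L) (su ∷ s-avoids) = su ∷ avoids-false s L s-avoids

avoids-true : ∀ {n} (s : Fin n → Bool) (L : List (Fin (suc n))) → zero ∉ L →
  Avoids s (shift L) → Avoids (true Vec.∷ s) L
avoids-true s []          _   _               = []
avoids-true s (zero ∷ L)  z∉L _               = ⊥-elim (z∉L (here refl))
avoids-true s (suc u ∷ L) z∉L (su ∷ s-avoids) = su ∷ avoids-true s L (z∉L ∘ there) s-avoids

subset-avoiding : ∀ n m (L : List (Fin n)) → length L ℕ.+ m ≤ n →
  Σ (Fin n → Bool) λ s → count s ≡ m × Avoids s L
subset-avoiding n       zero    L _ = (λ _ → false) , count-empty n , universal (λ _ → refl) L
  where
  count-empty : ∀ n → count {n} (λ _ → false) ≡ 0
  count-empty zero    = refl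
  count-empty (suc n) = count-empty n
subset-avoiding zero    (suc m) []      ()
subset-avoiding (suc n) (suc m) L room with any? (zero ≟_) L
... | no z∉L =
  let s , cs , s-avoids = subset-avoiding n m (shift L) (ℕP.≤-pred (ℕP.≤-trans shift-room room))
  in (true Vec.∷ s) , cong suc cs , avoids-true s L z∉L s-avoids
  where
  shift-room : suc (length (shift L) ℕ.+ m) ≤ length L ℕ.+ suc m
  shift-room = ℕP.≤-trans (ℕP.≤-reflexive (sym (ℕP.+-suc (length (shift L)) m)))
    (ℕP.+-monoˡ-≤ (suc m) (length-shift L))
... | yes z∈L =
  let s , cs , s-avoids = subset-avoiding n (suc m) (shift L) (ℕP.≤-pred (ℕP.≤-trans shift-room room))
  in (false Vec.∷ s) , cs , avoids-false s L s-avoids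
  where
  shift-room : suc (length (shift L) ℕ.+ suc m) ≤ length L ℕ.+ suc m
  shift-room = ℕP.+-monoˡ-≤ (suc m) (length-shift-∈ L z∈L)

fresh : ∀ {n} (L : List (Fin n)) → length L < n → Σ (Fin n) λ d → All (d ≢_) L
fresh {n} L L<n =
  let s , cs , s-avoids = subset-avoiding n 1 L (subst (_≤ n) (ℕP.+-comm 1 (length L)) L<n)
      d , sd = member s cs
  in d , All.map (λ su → member-≢ s su sd) s-avoids

-- Constant cubic sums force exchangeability

quadratic : ∀ {n} → (Fin n → Fin n → ℤ) → (Fin n → Bool) → ℤ
quadratic g s = ⟦ s ⟧ · λ v → ⟦ s ⟧ · g v

quadratic-insert : ∀ {n} (g : Fin n → Fin n → ℤ) s x → s x ≡ false →
  quadratic g (insert x s) ≡ quadratic g s + ⟦ s ⟧ · (λ v → g v x) + (⟦ s ⟧ · g x + g x x)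
quadratic-insert g s x sx = begin
  ⟦ insert x s ⟧ · (λ v → ⟦ insert x s ⟧ · g v)
    ≡⟨ ·-insert s x (λ v → ⟦ insert x s ⟧ · g v) sx ⟩
  ⟦ s ⟧ · (λ v → ⟦ insert x s ⟧ · g v) + ⟦ insert x s ⟧ · g x
    ≡⟨ cong₂ _+_ (·-congʳ ⟦ s ⟧ (λ v → ·-insert s x (g v) sx)) (·-insert s x (g x) sx) ⟩
  ⟦ s ⟧ · (λ v → ⟦ s ⟧ · g v + g v x) + (⟦ s ⟧ · g x + g x x)
    ≡⟨ cong (_+ (⟦ s ⟧ · g x + g x x))
            (·-distribˡ-+ ⟦ s ⟧ (λ v → ⟦ s ⟧ · g v) (λ v → g v x)) ⟩
  quadratic g s + ⟦ s ⟧ · (λ v → g v x) + (⟦ s ⟧ · g x + g x x) ∎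

cubic : ∀ {n} → (Fin n → Fin n → Fin n → ℤ) → (Fin n → Bool) → ℤ
cubic c s = ⟦ s ⟧ · λ u → quadratic (c u) s

cubic-insert : ∀ {n} {c : Fin n → Fin n → Fin n → ℤ} → SymmetricForm₃ c →
  ∀ s x → s x ≡ false → cubic c (insert x s) ≡ cubic c s + (+ 3) * quadratic (c x) s
cubic-insert {c = c} sym₃ s x sx = begin
  cubic c (insert x s)
    ≡⟨ ·-insert s x (λ u → quadratic (c u) (insert x s)) sx ⟩
  ⟦ s ⟧ · (λ u → quadratic (c u) (insert x s)) + quadratic (c x) (insert x s)
    ≡⟨ cong₂ _+_ (·-congʳ ⟦ s ⟧ at-other) at-inserted ⟩
  ⟦ s ⟧ · (λ u → quadratic (c u) s + (G u + G u)) + quadratic (c x) s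
    ≡⟨ cong (_+ quadratic (c x) s)
            (·-distribˡ-+ ⟦ s ⟧ (λ u → quadratic (c u) s) (λ u → G u + G u)) ⟩
  cubic c s + ⟦ s ⟧ · (λ u → G u + G u) + quadratic (c x) s
    ≡⟨ cong (λ t → cubic c s + t + quadratic (c x) s) (·-distribˡ-+ ⟦ s ⟧ G G) ⟩
  cubic c s + (quadratic (c x) s + quadratic (c x) s) + quadratic (c x) s
    ≡⟨ arith (cubic c s) (quadratic (c x) s) ⟩
  cubic c s + (+ 3) * quadratic (c x) s ∎
  where
  open SymmetricForm₃ sym₃
  G : Fin _ → ℤ
  G u = ⟦ s ⟧ · c x u
  at-other : ∀ u → quadratic (c u) (insert x s) ≡ quadratic (c u) s + (G u + G u)
  at-other u = trans (quadratic-insert (c u) s x sx)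
    (trans (cong₂ (λ a b → quadratic (c u) s + a + (b + c u x x))
                  (·-congʳ ⟦ s ⟧ (λ v → rotate u v x)) (·-congʳ ⟦ s ⟧ (λ w → swap₁₂ u x w)))
      (trans (cong (λ t → quadratic (c u) s + G u + (G u + t)) (repeated₂₃ u x))
        (arith′ (quadratic (c u) s) (G u))))
    where
    arith′ : ∀ q g → q + g + (g + 0ℤ) ≡ q + (g + g)
    arith′ = solve-∀
  at-inserted : quadratic (c x) (insert x s) ≡ quadratic (c x) s
  at-inserted = trans (quadratic-insert (c x) s x sx)
    (trans (cong₂ (λ a b → quadratic (c x) s + a + (b + c x x x))
                  (sum-*-vanishes ⟦ s ⟧ (λ v → c x v x) (repeated₁₃ x))
                  (sum-*-vanishes ⟦ s ⟧ (c x x) (repeated x)))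
      (trans (cong (λ t → quadratic (c x) s + 0ℤ + (0ℤ + t)) (repeated x x)) (arith′ (quadratic (c x) s))))
    where
    arith′ : ∀ q → q + 0ℤ + (0ℤ + 0ℤ) ≡ q
    arith′ = solve-∀
  arith : ∀ e b → e + (b + b) + b ≡ e + (+ 3) * b
  arith = solve-∀

cubic-cyclic≡6*threeCycles : ∀ {n} (M : Fin n → Fin n → ℤ) → ZeroDiagonal M →
  ∀ s k → count s ≡ k → Σ (Fin k → Fin n) λ f →
  StrictlyIncreasing f × (cubic (cyclic M) s ≡ (+ 6) * threeCycles (principal M f))
cubic-cyclic≡6*threeCycles M zd s _ refl with enumerate s
... | f , f-increasing , f-sum = f , f-increasing , (begin
  cubic (cyclic M) s                   ≡⟨ reindex ⟨
  sum³ (cyclic (principal M f))        ≡⟨ sum³-cyclic (principal M f) (zd ∘ f) ⟩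
  (+ 6) * threeCycles (principal M f)  ∎)
  where
  reindex : sum³ (cyclic (principal M f)) ≡ cubic (cyclic M) s
  reindex = trans (f-sum (λ u → ∑[ j < count s ] ∑[ l < count s ] cyclic M u (f j) (f l)))
    (·-congʳ ⟦ s ⟧ (λ u → trans (f-sum (λ v → ∑[ l < count s ] cyclic M u v (f l)))
                                (·-congʳ ⟦ s ⟧ (λ v → f-sum (cyclic M u v)))))

suc*≡0⇒≡0 : ∀ k x → + suc k * x ≡ 0ℤ → x ≡ 0ℤ
suc*≡0⇒≡0 k x eq = *-cancelˡ-≡ (+ suc k) x 0ℤ (trans eq (sym (*-zeroʳ (+ suc k))))

Exchangeable : ∀ {n} → (Fin n → Fin n → Fin n → ℤ) → Set
Exchangeable c = ∀ x y a b → x ≢ a → x ≢ b → y ≢ a → y ≢ b → a ≢ b → c x a b ≡ c y a b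

module Exchange {n} {c : Fin n → Fin n → Fin n → ℤ} (sym₃ : SymmetricForm₃ c)
  (m : ℕ) (room : 6 ℕ.+ m ≤ n)
  (cubic-constant : ∀ s s′ → count s ≡ 3 ℕ.+ m → count s′ ≡ 3 ℕ.+ m → cubic c s ≡ cubic c s′)
  where

  open SymmetricForm₃ sym₃

  quadratic-exchange : ∀ s x y → count s ≡ 2 ℕ.+ m → s x ≡ false → s y ≡ false →
    quadratic (c x) s ≡ quadratic (c y) s
  quadratic-exchange s x y cs sx sy = *-cancelˡ-≡ (+ 3) _ _ (+-cancelˡ (cubic c s) _ _ (begin
    cubic c s + (+ 3) * quadratic (c x) s  ≡⟨ cubic-insert sym₃ s x sx ⟨
    cubic c (insert x s)                   ≡⟨ cubic-constant _ _ (trans (count-insert s x sx) (cong suc cs))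
                                                                 (trans (count-insert s y sy) (cong suc cs)) ⟩
    cubic c (insert y s)                   ≡⟨ cubic-insert sym₃ s y sy ⟩
    cubic c s + (+ 3) * quadratic (c y) s  ∎))

  module Difference (x y : Fin n) where

    τ : Fin n → Fin n → ℤ
    τ v w = c x v w - c y v w

    τ-symmetric : ∀ v w → τ v w ≡ τ w v
    τ-symmetric v w = cong₂ _-_ (swap₂₃ x v w) (swap₂₃ y v w)

    τ-diagonal : ∀ v → τ v v ≡ 0ℤ
    τ-diagonal v = cong₂ _-_ (repeated₂₃ x v) (repeated₂₃ y v)

    Outside : Fin n → Set
    Outside u = x ≢ u × y ≢ u

    quadratic-τ-vanishes : ∀ s → count s ≡ 2 ℕ.+ m → s x ≡ false → s y ≡ false →
      quadratic τ s ≡ 0ℤ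
    quadratic-τ-vanishes s cs sx sy =
      trans (·-congʳ ⟦ s ⟧ (λ v → ·-distribˡ-- ⟦ s ⟧ (c x v) (c y v)))
        (trans (·-distribˡ-- ⟦ s ⟧ (λ v → ⟦ s ⟧ · c x v) (λ v → ⟦ s ⟧ · c y v))
          (i≡j⇒i-j≡0 (quadratic-exchange s x y cs sx sy)))

    quadratic-τ-insert : ∀ r a → r a ≡ false →
      quadratic τ (insert a r) ≡ quadratic τ r + (+ 2) * (⟦ r ⟧ · τ a)
    quadratic-τ-insert r a ra = trans expanded (arith (quadratic τ r) (⟦ r ⟧ · τ a))
      where
      expanded : quadratic τ (insert a r) ≡ quadratic τ r + ⟦ r ⟧ · τ a + (⟦ r ⟧ · τ a + 0ℤ)
      expanded = trans (quadratic-insert τ r a ra)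
        (cong₂ (λ p q → quadratic τ r + p + (⟦ r ⟧ · τ a + q))
               (·-congʳ ⟦ r ⟧ (λ v → τ-symmetric v a)) (τ-diagonal a))
      arith : ∀ q t → q + t + (t + 0ℤ) ≡ q + (+ 2) * t
      arith = solve-∀

    row-sums-agree : ∀ r a b → count r ≡ 1 ℕ.+ m → Avoids r (x ∷ y ∷ a ∷ b ∷ []) →
      Outside a → Outside b → ⟦ r ⟧ · τ a ≡ ⟦ r ⟧ · τ b
    row-sums-agree r a b cr (rx ∷ ry ∷ ra ∷ rb ∷ []) a-out b-out =
      *-cancelˡ-≡ (+ 2) _ _ (trans (twice-row-sum a ra a-out) (sym (twice-row-sum b rb b-out)))
      where
      twice-row-sum : ∀ a → r a ≡ false → Outside a → (+ 2) * (⟦ r ⟧ · τ a) ≡ - quadratic τ r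
      twice-row-sum a ra (x≢a , y≢a) = solve-for (quadratic τ r) _ (trans (sym (quadratic-τ-insert r a ra))
        (quadratic-τ-vanishes (insert a r) (trans (count-insert r a ra) (cong suc cr))
          (insert-∉ r a x rx x≢a) (insert-∉ r a y ry y≢a)))
        where
        solve-for : ∀ q t → q + t ≡ 0ℤ → t ≡ - q
        solve-for q t eq = trans (arith q t) (trans (cong (_- q) eq) (+-identityˡ (- q)))
          where
          arith : ∀ q t → t ≡ q + t - q
          arith = solve-∀

    τ-difference : ∀ q a b e → count q ≡ m → Avoids q (x ∷ y ∷ a ∷ b ∷ e ∷ []) →
      Outside a → Outside b → Outside e → a ≢ e → b ≢ e →
      τ a e - τ b e ≡ ⟦ q ⟧ · τ b - ⟦ q ⟧ · τ a
    τ-difference q a b e cq (qx ∷ qy ∷ qa ∷ qb ∷ qe ∷ []) a-out b-out (x≢e , y≢e) a≢e b≢e =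
      rearrange (⟦ q ⟧ · τ a) (⟦ q ⟧ · τ b) (τ a e) (τ b e) (begin
        ⟦ q ⟧ · τ a + τ a e   ≡⟨ ·-insert q e (τ a) qe ⟨
        ⟦ insert e q ⟧ · τ a  ≡⟨ row-sums-agree (insert e q) a b
                                   (trans (count-insert q e qe) (cong suc cq))
                                   (keep x x≢e qx ∷ keep y y≢e qy ∷
                                    keep a a≢e qa ∷ keep b b≢e qb ∷ [])
                                   a-out b-out ⟩
        ⟦ insert e q ⟧ · τ b  ≡⟨ ·-insert q e (τ b) qe ⟩
        ⟦ q ⟧ · τ b + τ b e   ∎)
      where
      keep : ∀ u → u ≢ e → q u ≡ false → insert e q u ≡ false
      keep u u≢e qu = insert-∉ q e u qu u≢e
      rearrange : ∀ A B p p′ → A + p ≡ B + p′ → p - p′ ≡ B - A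
      rearrange A B p p′ eq =
        trans (arith₁ A p p′) (trans (cong (λ t → t - (A + p′)) eq) (arith₂ A B p′))
        where
        arith₁ : ∀ A p p′ → p - p′ ≡ (A + p) - (A + p′)
        arith₁ = solve-∀
        arith₂ : ∀ A B p′ → (B + p′) - (A + p′) ≡ B - A
        arith₂ = solve-∀

    τ-first-irrelevant : ∀ a b e → Outside a → Outside b → Outside e → a ≢ e → b ≢ e →
      τ a e ≡ τ b e
    τ-first-irrelevant a b e a-out b-out e-out a≢e b≢e with a ≟ b
    ... | yes refl = refl
    ... | no a≢b
      with subset-avoiding n (1 ℕ.+ m) (x ∷ y ∷ a ∷ b ∷ []) (ℕP.≤-trans (ℕP.n≤1+n _) room)
    ...   | r , cr , r-avoids@(rx ∷ ry ∷ ra ∷ rb ∷ []) = i-j≡0⇒i≡j _ _ (suc*≡0⇒≡0 m δ (begin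
      + suc m * δ
        ≡⟨ cong (λ k → + k * δ) cr ⟨
      + count r * δ
        ≡⟨ ·-constant-on r (λ w → τ a w - τ b w) δ difference-constant ⟨
      ⟦ r ⟧ · (λ w → τ a w - τ b w)
        ≡⟨ ·-distribˡ-- ⟦ r ⟧ (τ a) (τ b) ⟩
      ⟦ r ⟧ · τ a - ⟦ r ⟧ · τ b
        ≡⟨ i≡j⇒i-j≡0 (row-sums-agree r a b cr r-avoids a-out b-out) ⟩
      0ℤ ∎))
      where
      δ = τ a e - τ b e
      difference-constant : ∀ w → r w ≡ true → τ a w - τ b w ≡ δ
      difference-constant w rw with w ≟ e
      ... | yes refl = refl
      ... | no w≢e with subset-avoiding n m (x ∷ y ∷ a ∷ b ∷ e ∷ w ∷ []) room
      ...   | q , cq , (qx ∷ qy ∷ qa ∷ qb ∷ qe ∷ qw ∷ []) =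
        trans (τ-difference q a b w cq (qx ∷ qy ∷ qa ∷ qb ∷ qw ∷ []) a-out b-out w-out
                 (≢-sym (member-≢ r ra rw)) (≢-sym (member-≢ r rb rw)))
          (sym (τ-difference q a b e cq (qx ∷ qy ∷ qa ∷ qb ∷ qe ∷ []) a-out b-out e-out a≢e b≢e))
        where
        w-out : Outside w
        w-out = ≢-sym (member-≢ r rx rw) , ≢-sym (member-≢ r ry rw)

    τ-constant : ∀ a e v w → Outside a → Outside e → Outside v → Outside w → a ≢ e → v ≢ w →
      τ v w ≡ τ a e
    τ-constant a e v w a-out e-out v-out w-out a≢e v≢w with w ≟ a
    ... | yes refl = trans (τ-first-irrelevant v e a v-out e-out a-out v≢w (≢-sym a≢e)) (τ-symmetric e a)
    ... | no w≢a   = begin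
      τ v w  ≡⟨ τ-first-irrelevant v a w v-out a-out w-out v≢w (≢-sym w≢a) ⟩
      τ a w  ≡⟨ τ-symmetric a w ⟩
      τ w a  ≡⟨ τ-first-irrelevant w e a w-out e-out a-out w≢a (≢-sym a≢e) ⟩
      τ e a  ≡⟨ τ-symmetric e a ⟩
      τ a e  ∎

    τ-vanishes : ∀ a e → Outside a → Outside e → a ≢ e → τ a e ≡ 0ℤ
    τ-vanishes a e a-out e-out a≢e
      with subset-avoiding n (2 ℕ.+ m) (x ∷ y ∷ []) (ℕP.≤-trans (ℕP.m≤n+m (4 ℕ.+ m) 2) room)
    ... | s , cs , (sx ∷ sy ∷ []) = suc*≡0⇒≡0 m t (suc*≡0⇒≡0 (suc m) (+ suc m * t) (begin
      + suc (suc m) * (+ suc m * t)  ≡⟨ cong (λ k → + k * (+ suc m * t)) cs ⟨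
      + count s * (+ suc m * t)      ≡⟨ ·-constant-on s (λ v → ⟦ s ⟧ · τ v) (+ suc m * t) row ⟨
      quadratic τ s                  ≡⟨ quadratic-τ-vanishes s cs sx sy ⟩
      0ℤ                             ∎))
      where
      t = τ a e
      outside : ∀ v → s v ≡ true → Outside v
      outside v sv = ≢-sym (member-≢ s sx sv) , ≢-sym (member-≢ s sy sv)
      row : ∀ v → s v ≡ true → ⟦ s ⟧ · τ v ≡ + suc m * t
      row v sv = solve-for (⟦ s ⟧ · τ v) (+ suc m) t (trans
        (·-constant-except s (τ v) t v sv (τ-diagonal v)
          (λ w sw w≢v → τ-constant a e v w a-out e-out (outside v sv) (outside w sw) a≢e (≢-sym w≢v)))
        (cong (λ k → + k * t) cs))
        where
        solve-for : ∀ X c t → X + t ≡ (1ℤ + c) * t → X ≡ c * t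
        solve-for X c t eq = trans (arith₁ X t) (trans (cong (_- t) eq) (arith₂ c t))
          where
          arith₁ : ∀ X t → X ≡ X + t - t
          arith₁ = solve-∀
          arith₂ : ∀ c t → (1ℤ + c) * t - t ≡ c * t
          arith₂ = solve-∀

  exchange : Exchangeable c
  exchange x y a b x≢a x≢b y≢a y≢b a≢b =
    i-j≡0⇒i≡j _ _ (Difference.τ-vanishes x y a b (x≢a , y≢a) (x≢b , y≢b) a≢b)

module _ {n} (T : Tournament n) where

  private
    A = adj T

  adj-zeroDiagonal : ZeroDiagonal A
  adj-zeroDiagonal i = cong (λ b → if b then 1ℤ else 0ℤ) (irrefl T i)

  adj-false : ∀ {u v} → dom T u v ≡ false → A u v ≡ 0ℤ
  adj-false = cong (λ b → if b then 1ℤ else 0ℤ)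

  dom-≢ : ∀ {u v} → dom T u v ≡ true → u ≢ v
  dom-≢ {u} uv refl with trans (sym uv) (irrefl T u)
  ... | ()

  dom-flip : ∀ {u v b} → u ≢ v → dom T u v ≡ b → dom T v u ≡ not b
  dom-flip u≢v uv = trans (tourn T _ _ (≢-sym u≢v)) (cong not uv)

  cyclic-on-3-cycle : ∀ u v w → dom T u v ≡ true → dom T v w ≡ true → dom T w u ≡ true →
    cyclic A u v w ≡ 1ℤ
  cyclic-on-3-cycle u v w uv vw wu rewrite uv | vw | wu | adj-false (dom-flip (dom-≢ uv) uv) =
    arith (A u w) (A w v)
    where
    arith : ∀ a b → 1ℤ * 1ℤ * 1ℤ + a * b * 0ℤ ≡ 1ℤ
    arith = solve-∀

  cyclic-on-common-source-or-sink : ∀ d p q → p ≢ d → q ≢ d → dom T d p ≡ dom T d q →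
    cyclic A d p q ≡ 0ℤ
  cyclic-on-common-source-or-sink d p q p≢d q≢d dp≡dq with dom T d p in dp
  ... | true  rewrite adj-false (dom-flip (≢-sym q≢d) (sym dp≡dq)) | adj-false (dom-flip (≢-sym p≢d) dp) =
    arith (A p q) (A d q) (A q p)
    where
    arith : ∀ a b c → 1ℤ * a * 0ℤ + b * c * 0ℤ ≡ 0ℤ
    arith = solve-∀
  ... | false rewrite adj-false (sym dp≡dq) = arith (A p q) (A q d) (A q p) (A p d)
    where
    arith : ∀ a b c e → 0ℤ * a * b + 0ℤ * c * e ≡ 0ℤ
    arith = solve-∀

  exchangeable⇒transitive : 4 ≤ n → Exchangeable (cyclic A) → Transitive T
  exchangeable⇒transitive 4≤n exch u v w uv vw with dom T u w in uw
  ... | true  = refl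
  ... | false with fresh (u ∷ v ∷ w ∷ []) 4≤n
  ...   | d , (d≢u ∷ d≢v ∷ d≢w ∷ []) =
    ⊥-elim (case pigeonhole (dom T d u) (dom T d v) (dom T d w) of λ where
    (inj₁ du≡dv)        → not-cyclic u v cduv (≢-sym d≢u) (≢-sym d≢v) du≡dv
    (inj₂ (inj₁ du≡dw)) → not-cyclic u w cduw (≢-sym d≢u) (≢-sym d≢w) du≡dw
    (inj₂ (inj₂ dv≡dw)) → not-cyclic v w cdvw (≢-sym d≢v) (≢-sym d≢w) dv≡dw)
    where
    open SymmetricForm₃ (cyclic-symmetric A adj-zeroDiagonal)
    u≢v = dom-≢ uv
    v≢w = dom-≢ vw
    u≢w : u ≢ w
    u≢w refl with trans (sym (dom-flip u≢v uv)) vw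
    ... | ()
    w≢u = ≢-sym u≢w
    cuvw : cyclic A u v w ≡ 1ℤ
    cuvw = cyclic-on-3-cycle u v w uv vw (dom-flip u≢w uw)
    cdvw : cyclic A d v w ≡ 1ℤ
    cdvw = trans (sym (exch u d v w u≢v u≢w d≢v d≢w v≢w)) cuvw
    cduw : cyclic A d u w ≡ 1ℤ
    cduw = trans (sym (exch v d u w (≢-sym u≢v) v≢w d≢u d≢w u≢w)) (trans (swap₁₂ v u w) cuvw)
    cduv : cyclic A d u v ≡ 1ℤ
    cduv = trans (sym (exch w d u v w≢u (≢-sym v≢w) d≢u d≢v u≢v)) (trans (sym (rotate u v w)) cuvw)
    pigeonhole : ∀ a b c → a ≡ b ⊎ a ≡ c ⊎ b ≡ c
    pigeonhole true  true  _     = inj₁ refl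
    pigeonhole false false _     = inj₁ refl
    pigeonhole true  false true  = inj₂ (inj₁ refl)
    pigeonhole false true  false = inj₂ (inj₁ refl)
    pigeonhole true  false false = inj₂ (inj₂ refl)
    pigeonhole false true  true  = inj₂ (inj₂ refl)
    not-cyclic : ∀ p q → cyclic A d p q ≡ 1ℤ → p ≢ d → q ≢ d → dom T d p ≡ dom T d q → ⊥
    not-cyclic p q cdpq p≢d q≢d dp≡dq
      with trans (sym cdpq) (cyclic-on-common-source-or-sink d p q p≢d q≢d dp≡dq)
    ... | ()

spectrallyMonomorphic⇒cubic-constant : ∀ {n} m (T : Tournament n) → SpectrallyMonomorphic (3 ℕ.+ m) T →
  ∀ s s′ → count s ≡ 3 ℕ.+ m → count s′ ≡ 3 ℕ.+ m →
  cubic (cyclic (adj T)) s ≡ cubic (cyclic (adj T)) s′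
spectrallyMonomorphic⇒cubic-constant m T sm s s′ cs cs′
  with cubic-cyclic≡6*threeCycles (adj T) (adj-zeroDiagonal T) s _ cs
     | cubic-cyclic≡6*threeCycles (adj T) (adj-zeroDiagonal T) s′ _ cs′
... | f , f-increasing , s≡ | g , g-increasing , s′≡ =
  trans s≡ (trans (cong ((+ 6) *_) (neg-injective same-coefficient)) (sym s′≡))
  where
  same-coefficient : - threeCycles (principal (adj T) f) ≡ - threeCycles (principal (adj T) g)
  same-coefficient = begin
    - threeCycles (principal (adj T) f)
      ≡⟨ coeff-charPoly-cubic m (principal (adj T) f) (adj-zeroDiagonal T ∘ f) ⟨
    coeff (charPoly (3 ℕ.+ m) (principal (adj T) f)) m
      ≡⟨ sm f g f-increasing g-increasing m ⟩
    coeff (charPoly (3 ℕ.+ m) (principal (adj T) g)) m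
      ≡⟨ coeff-charPoly-cubic m (principal (adj T) g) (adj-zeroDiagonal T ∘ g) ⟩
    - threeCycles (principal (adj T) g) ∎

proposition3p1 : ∀ (n k : ℕ) → 6 ≤ n → 3 ≤ k → k ≤ n ∸ 3 →
    (T : Tournament n) → SpectrallyMonomorphic k T → Transitive T
proposition3p1 n (suc (suc (suc m))) 6≤n (s≤s (s≤s (s≤s _))) k≤n∸3 T sm =
  exchangeable⇒transitive T (ℕP.≤-trans (ℕP.m≤n+m 4 2) 6≤n)
    (Exchange.exchange (cyclic-symmetric (adj T) (adj-zeroDiagonal T)) m room
      (spectrallyMonomorphic⇒cubic-constant m T sm))
  where
  room : 6 ℕ.+ m ≤ n
  room = ℕP.≤-trans (ℕP.≤-reflexive (ℕP.+-comm 3 (3 ℕ.+ m)))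
    (ℕP.≤-trans (ℕP.+-monoˡ-≤ 3 k≤n∸3)
      (ℕP.≤-reflexive (ℕP.m∸n+n≡m (ℕP.≤-trans (ℕP.m≤n+m 3 3) 6≤n))))
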